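{- If $G$ is a connected $3$-regular graph distinct from $K_4$ and $K_{3,3}$, then $q(G)=\frac34$.
   Context: All graphs are finite, simple and undirected. For a vertex $v$, $d(v)$ is its degree, $N[v]$ its closed neighbourhood and $d[v]=d(v)+1$. A partition of $G$ is a pair $(V_1,V_2)$ of nonempty disjoint sets with union $V(G)$; for $v\in V_i$, $q^i(v)=|N[v]\cap V_i|/d[v]$, and $q(G)=\max_{(V_1,V_2)}\min\{q^i(v): i\in\{1,2\}, v\in V_i\}$ over all partitions. -}

module Defs where

open import Data.Bool using (Bool; true; false; not; _xor_; if_then_else_)
open import Data.Bool.Properties using (xor-comm; xor-same)
open import Data.Nat using (ℕ; zero; suc; _+_; _<ᵇ_)
open import Data.Fin using (Fin; toℕ; _≟_)
open import Data.Integer using (+_)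
open import Data.Rational using (ℚ; _/_; _≤_)
open import Data.Product using (Σ; ∃; _×_; _,_)
open import Data.Empty using (⊥-elim)
open import Function.Bundles using (_⤖_; Bijection)
open import Relation.Binary.PropositionalEquality using (_≡_; refl)
open import Relation.Nullary using (yes; no)
open import Relation.Nullary.Decidable using (⌊_⌋)

record Graph (n : ℕ) : Set where
  field
    adj    : Fin n → Fin n → Bool
    sym    : ∀ u v → adj u v ≡ adj v u
    irrefl : ∀ v → adj v v ≡ false
open Graph public

count : ∀ {n} → (Fin n → Bool) → ℕ
count {zero}  p = 0
count {suc n} p = (if p Fin.zero then 1 else 0) + count {n} (λ i → p (Fin.suc i))

deg : ∀ {n} → Graph n → Fin n → ℕ
deg G v = count (adj G v)

Regular : ∀ {n} → ℕ → Graph n → Set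
Regular k G = ∀ v → deg G v ≡ k

data Reach {n} (G : Graph n) : Fin n → Fin n → Set where
  here : ∀ {u} → Reach G u u
  step : ∀ {u v w} → adj G u v ≡ true → Reach G v w → Reach G u w

Connected : ∀ {n} → Graph n → Set
Connected G = ∀ u v → Reach G u v

_≅_ : ∀ {n m} → Graph n → Graph m → Set
_≅_ {n} {m} G H = Σ (Fin n ⤖ Fin m) λ f →
  ∀ u v → adj G u v ≡ adj H (Bijection.to f u) (Bijection.to f v)

neq : ∀ {n} → Fin n → Fin n → Bool
neq u v = not ⌊ u ≟ v ⌋

neq-sym : ∀ {n} (u v : Fin n) → neq u v ≡ neq v u
neq-sym u v with u ≟ v | v ≟ u
... | yes _ | yes _ = refl
... | no  _ | no  _ = refl
... | yes p | no ¬q = ⊥-elim (¬q (Relation.Binary.PropositionalEquality.sym p))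
... | no ¬p | yes q = ⊥-elim (¬p (Relation.Binary.PropositionalEquality.sym q))

neq-irrefl : ∀ {n} (v : Fin n) → neq v v ≡ false
neq-irrefl v with v ≟ v
... | yes _ = refl
... | no ¬p = ⊥-elim (¬p refl)

Complete : (n : ℕ) → Graph n
Complete n = record { adj = neq ; sym = neq-sym ; irrefl = neq-irrefl }

K4 : Graph 4
K4 = Complete 4

side33 : Fin 6 → Bool
side33 v = toℕ v <ᵇ 3

K33 : Graph 6
K33 = record
  { adj    = λ u v → side33 u xor side33 v
  ; sym    = λ u v → xor-comm (side33 u) (side33 v)
  ; irrefl = λ v → xor-same (side33 v)
  }

-- A partition (V₁,V₂) is encoded by σ : Fin n → Bool
-- (V₁ = σ⁻¹(true), V₂ = σ⁻¹(false)), both parts nonempty.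
record Partition {n} (G : Graph n) : Set where
  field
    σ     : Fin n → Bool
    nonempty₁ : ∃ λ v → σ v ≡ true
    nonempty₂ : ∃ λ v → σ v ≡ false
open Partition public

inClosedNbhd : ∀ {n} → Graph n → Fin n → Fin n → Bool
inClosedNbhd G v w = if ⌊ v ≟ w ⌋ then true else adj G v w

-- q^i(v) = |N[v] ∩ V_i| / d[v], for the part V_i containing v
qv : ∀ {n} (G : Graph n) → Partition G → Fin n → ℚ
qv G P v =
  + count (λ w → if inClosedNbhd G v w then not (σ P w xor σ P v) else false)
    / suc (deg G v)

-- q(G) = r, i.e. r = max over partitions of min over vertices of q^i(v):
-- some partition attains min ≥ r, and every partition has min ≤ r.
HasQ : ∀ {n} → Graph n → ℚ → Set
HasQ G r =
  (Σ (Partition G) λ P → ∀ v → r ≤ qv G P v) ×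
  (∀ (P : Partition G) → ∃ λ v → qv G P v ≤ r)

-- A partition has min q ≥ 3/4 exactly when every vertex has at least two of its three
-- neighbours in its own part, while every partition has min q ≤ 3/4, witnessed by an end of
-- an edge between the two parts, which exists by connectivity.
--
-- Call S ⊆ V dense if it spans at least |S| edges. In a partition into two nonempty dense
-- parts, moving a vertex with at most one neighbour on its side to the other side keeps both
-- parts nonempty and dense and increases the number of edges inside the parts, so this local
-- search ends in a partition as required.
--
-- Such a starting partition is found by shrinking a dense set T, beginning with V, until its
-- complement is dense too: a vertex with at most one neighbour in T can be removed, and by
-- parity so can one with two if another has three, or any vertex if all have three. If T
-- induces a 2-regular graph and ∁ T is not dense, then |∁ T| < |T| and some x ∉ T has two
-- neighbours in T; x can be exchanged for two adjacent vertices of T unless |T| = 3 and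
-- G = K₄, or G = K₃,₃.

module Submission where

open import Defs hiding (sym)
import Data.Nat.Properties as ℕ using (_≟_; +-*-semiring)
open import Algebra.Properties.Semiring.Sum ℕ.+-*-semiring
  using (sum-syntax; sum-cong-≗; ∑-distrib-+; ∑-comm; *-distribˡ-sum)
open import Data.Bool using (Bool; true; false; not; _xor_; if_then_else_; _∧_; _∨_)
open import Data.Bool.Properties
  using (not-involutive; xor-same; ∧-comm; ∧-zeroʳ; ∧-identityʳ; ∧-conicalˡ; ∧-conicalʳ)
  renaming (_≟_ to _≟ᵇ_)
open import Data.Empty using (⊥-elim)
open import Data.Fin as Fin using (Fin; _≟_)
open import Data.Fin.Patterns using (0F; 1F; 2F; 3F; 4F; 5F)
open import Data.Fin.Properties using (any?)
open import Data.Nat using (ℕ; zero; suc; _+_; _*_; _≤_; _<_; z≤n; s≤s; s≤s⁻¹)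
open import Data.Nat.Properties hiding (_≟_)
open import Data.Nat.Tactic.RingSolver using (solve-∀)
open import Data.Product using (Σ; ∃; _×_; _,_; proj₁; proj₂)
open import Data.Sum using (_⊎_; inj₁; inj₂)
open import Function using (_∘_)
open import Function.Bundles using (mk↔ₛ′)
open import Function.Construct.Identity using (⤖-id)
open import Function.Properties.Inverse using (↔⇒⤖)
open import Relation.Binary.PropositionalEquality
open import Relation.Nullary using (¬_; Dec; does; yes; no)
open import Relation.Nullary.Decidable using (_×-dec_; _⊎-dec_; from-yes)

false≢true : false ≢ true
false≢true ()

not-true : ∀ {b} → not b ≡ true → b ≡ false
not-true {false} _ = refl

𝟙 : Bool → ℕ
𝟙 b = if b then 1 else 0

𝟙≤1 : ∀ b → 𝟙 b ≤ 1
𝟙≤1 true  = ≤-refl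
𝟙≤1 false = z≤n

Pred : ℕ → Set
Pred n = Fin n → Bool

∑-mono-≤ : ∀ {n} {f g : Fin n → ℕ} → (∀ i → f i ≤ g i) → ∑[ i < n ] f i ≤ ∑[ i < n ] g i
∑-mono-≤ {zero}  f≤g = z≤n
∑-mono-≤ {suc n} f≤g = +-mono-≤ (f≤g Fin.zero) (∑-mono-≤ (f≤g ∘ Fin.suc))

∑-const : ∀ n c → ∑[ i < n ] c ≡ n * c
∑-const zero    c = refl
∑-const (suc n) c = cong (c +_) (∑-const n c)

-- does rather than ⌊_⌋, so that suc x == suc w reduces to x == w.
_==_ : ∀ {n} → Fin n → Fin n → Bool
x == w = does (x ≟ w)

==-refl : ∀ {n} (x : Fin n) → (x == x) ≡ true
==-refl x with x ≟ x
... | yes _    = refl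
... | no x≢x   = ⊥-elim (x≢x refl)

==-≢ : ∀ {n} {x w : Fin n} → x ≢ w → (x == w) ≡ false
==-≢ {x = x} {w} x≢w with x ≟ w
... | yes x≡w = ⊥-elim (x≢w x≡w)
... | no _    = refl

==⇒≡ : ∀ {n} (x w : Fin n) → (x == w) ≡ true → x ≡ w
==⇒≡ x w x==w with x ≟ w
... | yes x≡w = x≡w

∑-δ : ∀ {n} (f : Fin n → ℕ) x → ∑[ w < n ] (if x == w then f w else 0) ≡ f x
∑-δ {suc n} f Fin.zero    = trans (cong (f Fin.zero +_) (trans (∑-const n 0) (*-zeroʳ n))) (+-identityʳ _)
∑-δ {suc n} f (Fin.suc x) = ∑-δ {n} (f ∘ Fin.suc) x

count-∑ : ∀ {n} (p : Pred n) → count p ≡ ∑[ w < n ] 𝟙 (p w)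
count-∑ {zero}  p = refl
count-∑ {suc n} p = cong (𝟙 (p Fin.zero) +_) (count-∑ (p ∘ Fin.suc))

module _ {n : ℕ} where

  _⊆_ : Pred n → Pred n → Set
  p ⊆ q = ∀ w → p w ≡ true → q w ≡ true

  ∁ : Pred n → Pred n
  ∁ p w = not (p w)

  own-side : Pred n → Fin n → Pred n
  own-side V₁ v w = not (V₁ w xor V₁ v)

  Nonempty : Pred n → Set
  Nonempty p = ∃ λ w → p w ≡ true

  insert : Fin n → Pred n → Pred n
  insert x S w = (x == w) ∨ S w

  remove : Fin n → Pred n → Pred n
  remove x S w = not (x == w) ∧ S w

  count-cong : ∀ {p q : Pred n} → p ≗ q → count p ≡ count q
  count-cong {p} {q} p≗q =
    trans (count-∑ p) (trans (sum-cong-≗ (cong 𝟙 ∘ p≗q)) (sym (count-∑ q)))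

  count-+ : ∀ {p q r : Pred n} → (∀ w → 𝟙 (p w) ≡ 𝟙 (q w) + 𝟙 (r w)) →
            count p ≡ count q + count r
  count-+ {p} {q} {r} split = begin
    count p                                  ≡⟨ count-∑ p ⟩
    ∑[ w < n ] 𝟙 (p w)                       ≡⟨ sum-cong-≗ split ⟩
    ∑[ w < n ] (𝟙 (q w) + 𝟙 (r w))           ≡⟨ ∑-distrib-+ (𝟙 ∘ q) (𝟙 ∘ r) ⟩
    ∑[ w < n ] 𝟙 (q w) + ∑[ w < n ] 𝟙 (r w)  ≡⟨ cong₂ _+_ (count-∑ q) (count-∑ r) ⟨
    count q + count r                        ∎
    where open ≡-Reasoning

  count-split : ∀ (p q : Pred n) →
                count p ≡ count (λ w → p w ∧ q w) + count (λ w → p w ∧ not (q w))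
  count-split p q = count-+ split
    where
    split : ∀ w → 𝟙 (p w) ≡ 𝟙 (p w ∧ q w) + 𝟙 (p w ∧ not (q w))
    split w with p w | q w
    ... | true  | true  = refl
    ... | true  | false = refl
    ... | false | _     = refl

  count-mono : ∀ {p q : Pred n} → p ⊆ q → count p ≤ count q
  count-mono {p} {q} p⊆q =
    subst₂ _≤_ (sym (count-∑ p)) (sym (count-∑ q)) (∑-mono-≤ 𝟙-mono)
    where
    𝟙-mono : ∀ w → 𝟙 (p w) ≤ 𝟙 (q w)
    𝟙-mono w with p w in pw
    ... | true  rewrite p⊆q w pw = ≤-refl
    ... | false = z≤n

  count-const : ∀ b → count {n} (λ _ → b) ≡ n * 𝟙 b
  count-const b = trans (count-∑ {n} (λ _ → b)) (∑-const n (𝟙 b))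

  count-+-∁ : ∀ (p : Pred n) → count p + count (∁ p) ≡ n
  count-+-∁ p = trans (sym (count-split (λ _ → true) p)) (trans (count-const true) (*-identityʳ n))

  count-== : ∀ (p : Pred n) x → count (λ w → p w ∧ (x == w)) ≡ 𝟙 (p x)
  count-== p x = trans (count-∑ (λ w → p w ∧ (x == w))) (trans (sum-cong-≗ at-x) (∑-δ (𝟙 ∘ p) x))
    where
    at-x : ∀ w → 𝟙 (p w ∧ (x == w)) ≡ (if x == w then 𝟙 (p w) else 0)
    at-x w with x == w
    ... | true  = cong 𝟙 (∧-identityʳ (p w))
    ... | false = cong 𝟙 (∧-zeroʳ (p w))

  count-singleton : ∀ x → count (x ==_) ≡ 1
  count-singleton = count-== (λ _ → true)

  count-pos⇒nonempty : ∀ (p : Pred n) → 0 < count p → Nonempty p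
  count-pos⇒nonempty p 0<count with any? (λ w → p w ≟ᵇ true)
  ... | yes found = found
  ... | no none = ⊥-elim (<-irrefl (sym count≡0) 0<count)
    where
    all-false : ∀ w → p w ≡ false
    all-false w with p w in pw
    ... | true  = ⊥-elim (none (w , pw))
    ... | false = refl
    count≡0 : count p ≡ 0
    count≡0 = trans (count-cong all-false) (trans (count-const false) (*-zeroʳ n))

  nonempty⇒count-pos : ∀ {p : Pred n} {w} → p w ≡ true → 0 < count p
  nonempty⇒count-pos {p} {w} pw = ≤-trans (≤-reflexive (sym (count-singleton w))) (count-mono singleton⊆p)
    where
    singleton⊆p : (w ==_) ⊆ p
    singleton⊆p v w==v = subst (λ u → p u ≡ true) (==⇒≡ w v w==v) pw

  ⊆∧count≤⇒≗ : ∀ {p q : Pred n} → p ⊆ q → count q ≤ count p → p ≗ q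
  ⊆∧count≤⇒≗ {p} {q} p⊆q count-q≤p w with p w in pw | q w in qw
  ... | true  | true  = refl
  ... | false | false = refl
  ... | true  | false = ⊥-elim (false≢true (trans (sym qw) (p⊆q w pw)))
  ... | false | true  = ⊥-elim (<⇒≱ count-p<q count-q≤p)
    where
    q∧p≗p : (λ v → q v ∧ p v) ≗ p
    q∧p≗p v with p v in pv
    ... | true  = cong (_∧ true) (p⊆q v pv)
    ... | false = ∧-zeroʳ (q v)
    count-p<q : count p < count q
    count-p<q = begin-strict
      count p      ≡⟨ +-identityʳ (count p) ⟨
      count p + 0  <⟨ +-monoʳ-< (count p) (nonempty⇒count-pos {λ v → q v ∧ not (p v)} {w}
                                                                (cong₂ _∧_ qw (cong not pw))) ⟩
      count p + count (λ v → q v ∧ not (p v))                  ≡⟨ cong (_+ count (λ v → q v ∧ not (p v))) (count-cong q∧p≗p) ⟨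
      count (λ v → q v ∧ p v) + count (λ v → q v ∧ not (p v))  ≡⟨ count-split q p ⟨
      count q                                                  ∎
      where open ≤-Reasoning

  remove-self : ∀ x S → remove x S x ≡ false
  remove-self x S rewrite ==-refl x = refl

  remove-≢ : ∀ {x w} S → x ≢ w → remove x S w ≡ S w
  remove-≢ S x≢w rewrite ==-≢ x≢w = refl

  remove-⊆ : ∀ x S → remove x S ⊆ S
  remove-⊆ x S w xw with x == w
  ... | false = xw

  insert-remove : ∀ {S x} → S x ≡ true → insert x (remove x S) ≗ S
  insert-remove {S} {x} Sx w with x ≟ w
  ... | yes refl = sym Sx
  ... | no _     = refl

  count-insert : ∀ {S x} → S x ≡ false → count (insert x S) ≡ suc (count S)
  count-insert {S} {x} Sx = trans (count-+ split) (cong (_+ count S) (count-singleton x))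
    where
    split : ∀ w → 𝟙 (insert x S w) ≡ 𝟙 (x == w) + 𝟙 (S w)
    split w with x ≟ w
    ... | yes refl rewrite Sx = refl
    ... | no _     = refl

  count-remove : ∀ {S x} → S x ≡ true → count S ≡ suc (count (remove x S))
  count-remove {S} {x} Sx =
    trans (count-cong (sym ∘ insert-remove Sx)) (count-insert (remove-self x S))

  count-remove-< : ∀ {S x} → S x ≡ true → count (remove x S) < count S
  count-remove-< {S} Sx = ≤-reflexive (sym (count-remove {S = S} Sx))

  count≤1⇒unique : ∀ {S a b} → count S ≤ 1 → S a ≡ true → S b ≡ true → a ≡ b
  count≤1⇒unique {S} {a} {b} count≤1 Sa Sb =
    ==⇒≡ a b (trans (a==≗S b) Sb)
    where
    a==⊆S : (a ==_) ⊆ S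
    a==⊆S w a==w = subst (λ v → S v ≡ true) (==⇒≡ a w a==w) Sa
    a==≗S : (a ==_) ≗ S
    a==≗S = ⊆∧count≤⇒≗ a==⊆S (subst (count S ≤_) (sym (count-singleton a)) count≤1)

  enumerate₂ : ∀ {S} → count S ≡ 2 → Σ (Fin n) λ a → Σ (Fin n) λ b →
               S a ≡ true × S b ≡ true × a ≢ b × (∀ w → S w ≡ true → w ≡ a ⊎ w ≡ b)
  enumerate₂ {S} count≡2 = a , b , Sa , remove-⊆ a S b S′b , a≢b , cover
    where
    a-in-S = count-pos⇒nonempty S (subst (0 <_) (sym count≡2) (s≤s z≤n))
    a = proj₁ a-in-S
    Sa = proj₂ a-in-S
    count-rest : count (remove a S) ≡ 1
    count-rest = suc-injective (trans (sym (count-remove Sa)) count≡2)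
    b-in-rest = count-pos⇒nonempty (remove a S) (subst (0 <_) (sym count-rest) (s≤s z≤n))
    b = proj₁ b-in-rest
    S′b = proj₂ b-in-rest
    a≢b : a ≢ b
    a≢b a≡b = false≢true (trans (sym (remove-self a S)) (subst (λ v → remove a S v ≡ true) (sym a≡b) S′b))
    cover : ∀ w → S w ≡ true → w ≡ a ⊎ w ≡ b
    cover w Sw with a ≟ w
    ... | yes a≡w = inj₁ (sym a≡w)
    ... | no a≢w  = inj₂ (count≤1⇒unique {remove a S} (≤-reflexive count-rest)
                                          (trans (remove-≢ S a≢w) Sw) S′b)

∧-rotate : ∀ p a q → p ∧ (a ∧ q) ≡ q ∧ (a ∧ p)
∧-rotate true  a true  = refl
∧-rotate true  a false = ∧-zeroʳ a
∧-rotate false a true  = sym (∧-zeroʳ a)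
∧-rotate false a false = refl

∑-if : ∀ {n} (P : Pred n) k → ∑[ v < n ] (if P v then k else 0) ≡ k * count P
∑-if {n} P k = begin
  ∑[ v < n ] (if P v then k else 0)  ≡⟨ sum-cong-≗ pointwise ⟩
  ∑[ v < n ] (k * 𝟙 (P v))           ≡⟨ *-distribˡ-sum k (𝟙 ∘ P) ⟨
  k * ∑[ v < n ] 𝟙 (P v)             ≡⟨ cong (k *_) (count-∑ P) ⟨
  k * count P                        ∎
  where
  open ≡-Reasoning
  pointwise : ∀ v → (if P v then k else 0) ≡ k * 𝟙 (P v)
  pointwise v with P v
  ... | true  = sym (*-identityʳ k)
  ... | false = sym (*-zeroʳ k)

module Degrees {n : ℕ} (G : Graph n) where

  degIn : Pred n → Fin n → ℕ
  degIn S v = count (λ w → adj G v w ∧ S w)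

  -- The number of ordered pairs of adjacent vertices in P × Q; arcs S S is twice the number
  -- of edges inside S.
  arcs : Pred n → Pred n → ℕ
  arcs P Q = ∑[ v < n ] (if P v then degIn Q v else 0)

  degIn-cong : ∀ {S S′} → S ≗ S′ → ∀ v → degIn S v ≡ degIn S′ v
  degIn-cong S≗S′ v = count-cong (λ w → cong (adj G v w ∧_) (S≗S′ w))

  degIn-≤-count : ∀ S v → degIn S v ≤ count S
  degIn-≤-count S v = count-mono (λ w → ∧-conicalʳ (adj G v w) (S w))

  degIn-+-∁ : ∀ S v → degIn S v + degIn (∁ S) v ≡ deg G v
  degIn-+-∁ S v = sym (count-split (adj G v) S)

  degIn-insert : ∀ {S x} → S x ≡ false → ∀ v → degIn (insert x S) v ≡ 𝟙 (adj G v x) + degIn S v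
  degIn-insert {S} {x} Sx v =
    trans (count-+ split) (cong (_+ degIn S v) (count-== (adj G v) x))
    where
    split : ∀ w → 𝟙 (adj G v w ∧ insert x S w) ≡ 𝟙 (adj G v w ∧ (x == w)) + 𝟙 (adj G v w ∧ S w)
    split w with x ≟ w
    ... | yes refl rewrite Sx | ∧-zeroʳ (adj G v x) = sym (+-identityʳ _)
    ... | no _     rewrite ∧-zeroʳ (adj G v w) = refl

  degIn-remove : ∀ {S x} → S x ≡ true → ∀ v → degIn S v ≡ 𝟙 (adj G v x) + degIn (remove x S) v
  degIn-remove {S} {x} Sx v =
    trans (degIn-cong (sym ∘ insert-remove Sx) v) (degIn-insert (remove-self x S) v)

  degIn-remove-self : ∀ {S x} → S x ≡ true → degIn S x ≡ degIn (remove x S) x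
  degIn-remove-self {S} {x} Sx =
    trans (degIn-remove Sx x) (cong (λ b → 𝟙 b + degIn (remove x S) x) (irrefl G x))

  arcs-cong : ∀ {P P′ Q Q′} → P ≗ P′ → Q ≗ Q′ → arcs P Q ≡ arcs P′ Q′
  arcs-cong {P} {P′} {Q} {Q′} P≗P′ Q≗Q′ = sum-cong-≗ pointwise
    where
    pointwise : ∀ v → (if P v then degIn Q v else 0) ≡ (if P′ v then degIn Q′ v else 0)
    pointwise v rewrite P≗P′ v with P′ v
    ... | true  = degIn-cong Q≗Q′ v
    ... | false = refl

  arcs-∑∑ : ∀ P Q → arcs P Q ≡ ∑[ v < n ] ∑[ w < n ] 𝟙 (P v ∧ (adj G v w ∧ Q w))
  arcs-∑∑ P Q = sum-cong-≗ row
    where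
    row : ∀ v → (if P v then degIn Q v else 0) ≡ ∑[ w < n ] 𝟙 (P v ∧ (adj G v w ∧ Q w))
    row v with P v
    ... | true  = count-∑ (λ w → adj G v w ∧ Q w)
    ... | false = sym (trans (∑-const n 0) (*-zeroʳ n))

  arcs-sym : ∀ P Q → arcs P Q ≡ arcs Q P
  arcs-sym P Q = begin
    arcs P Q                                           ≡⟨ arcs-∑∑ P Q ⟩
    ∑[ v < n ] ∑[ w < n ] 𝟙 (P v ∧ (adj G v w ∧ Q w))  ≡⟨ ∑-comm (λ v w → 𝟙 (P v ∧ (adj G v w ∧ Q w))) ⟩
    ∑[ w < n ] ∑[ v < n ] 𝟙 (P v ∧ (adj G v w ∧ Q w))  ≡⟨ sum-cong-≗ (λ w → sum-cong-≗ (λ v → cong 𝟙 (flip v w))) ⟩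
    ∑[ w < n ] ∑[ v < n ] 𝟙 (Q w ∧ (adj G w v ∧ P v))  ≡⟨ arcs-∑∑ Q P ⟨
    arcs Q P                                           ∎
    where
    open ≡-Reasoning
    flip : ∀ v w → P v ∧ (adj G v w ∧ Q w) ≡ Q w ∧ (adj G w v ∧ P v)
    flip v w rewrite Graph.sym G v w = ∧-rotate (P v) (adj G w v) (Q w)

  arcs-≤ : ∀ P Q k → (∀ v → P v ≡ true → degIn Q v ≤ k) → arcs P Q ≤ k * count P
  arcs-≤ P Q k bound = ≤-trans (∑-mono-≤ pointwise) (≤-reflexive (∑-if P k))
    where
    pointwise : ∀ v → (if P v then degIn Q v else 0) ≤ (if P v then k else 0)
    pointwise v with P v in Pv
    ... | true  = bound v Pv
    ... | false = z≤n

  arcs-≥ : ∀ P Q k → (∀ v → P v ≡ true → k ≤ degIn Q v) → k * count P ≤ arcs P Q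
  arcs-≥ P Q k bound = ≤-trans (≤-reflexive (sym (∑-if P k))) (∑-mono-≤ pointwise)
    where
    pointwise : ∀ v → (if P v then k else 0) ≤ (if P v then degIn Q v else 0)
    pointwise v with P v in Pv
    ... | true  = bound v Pv
    ... | false = z≤n

  arcs-≡ : ∀ P Q k → (∀ v → P v ≡ true → degIn Q v ≡ k) → arcs P Q ≡ k * count P
  arcs-≡ P Q k exact = ≤-antisym (arcs-≤ P Q k (λ v Pv → ≤-reflexive (exact v Pv)))
                                 (arcs-≥ P Q k (λ v Pv → ≤-reflexive (sym (exact v Pv))))

  arcs-+-∁ : ∀ {k} → Regular k G → ∀ P Q → arcs P Q + arcs P (∁ Q) ≡ k * count P
  arcs-+-∁ {k} regular P Q = begin
    arcs P Q + arcs P (∁ Q)            ≡⟨ ∑-distrib-+ (λ v → if P v then degIn Q v else 0) _ ⟨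
    ∑[ v < n ] ((if P v then degIn Q v else 0) + (if P v then degIn (∁ Q) v else 0))
                                       ≡⟨ sum-cong-≗ pointwise ⟩
    ∑[ v < n ] (if P v then k else 0)  ≡⟨ ∑-if P k ⟩
    k * count P                        ∎
    where
    open ≡-Reasoning
    pointwise : ∀ v → (if P v then degIn Q v else 0) + (if P v then degIn (∁ Q) v else 0)
                      ≡ (if P v then k else 0)
    pointwise v with P v
    ... | true  = trans (degIn-+-∁ Q v) (regular v)
    ... | false = refl

  arcs-insertˡ : ∀ {P x} → P x ≡ false → ∀ Q → arcs (insert x P) Q ≡ degIn Q x + arcs P Q
  arcs-insertˡ {P} {x} Px Q = begin
    arcs (insert x P) Q                          ≡⟨ sum-cong-≗ split ⟩
    ∑[ v < n ] ((if x == v then degIn Q v else 0) + (if P v then degIn Q v else 0))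
                                                 ≡⟨ ∑-distrib-+ (λ v → if x == v then degIn Q v else 0) _ ⟩
    ∑[ v < n ] (if x == v then degIn Q v else 0) + arcs P Q
                                                 ≡⟨ cong (_+ arcs P Q) (∑-δ (degIn Q) x) ⟩
    degIn Q x + arcs P Q                         ∎
    where
    open ≡-Reasoning
    split : ∀ v → (if insert x P v then degIn Q v else 0)
                  ≡ (if x == v then degIn Q v else 0) + (if P v then degIn Q v else 0)
    split v with x ≟ v
    ... | yes refl rewrite Px = sym (+-identityʳ _)
    ... | no _     = refl

  arcs-removeˡ : ∀ {S x} → S x ≡ true → ∀ Q → arcs S Q ≡ degIn Q x + arcs (remove x S) Q
  arcs-removeˡ {S} {x} Sx Q =
    trans (arcs-cong (sym ∘ insert-remove {S = S} Sx) (λ _ → refl)) (arcs-insertˡ (remove-self x S) Q)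

  arcs-insert : ∀ {S x} → S x ≡ false → arcs (insert x S) (insert x S) ≡ arcs S S + (degIn S x + degIn S x)
  arcs-insert {S} {x} Sx = begin
    arcs (insert x S) (insert x S)              ≡⟨ arcs-insertˡ Sx (insert x S) ⟩
    degIn (insert x S) x + arcs S (insert x S)  ≡⟨ cong₂ _+_ degIn-self (arcs-sym S (insert x S)) ⟩
    degIn S x + arcs (insert x S) S             ≡⟨ cong (degIn S x +_) (arcs-insertˡ Sx S) ⟩
    degIn S x + (degIn S x + arcs S S)          ≡⟨ +-assoc (degIn S x) (degIn S x) (arcs S S) ⟨
    degIn S x + degIn S x + arcs S S            ≡⟨ +-comm (degIn S x + degIn S x) (arcs S S) ⟩
    arcs S S + (degIn S x + degIn S x)          ∎
    where
    open ≡-Reasoning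
    degIn-self : degIn (insert x S) x ≡ degIn S x
    degIn-self = trans (degIn-insert Sx x) (cong (λ b → 𝟙 b + degIn S x) (irrefl G x))

  arcs-remove : ∀ {S x} → S x ≡ true →
                arcs S S ≡ arcs (remove x S) (remove x S) + (degIn S x + degIn S x)
  arcs-remove {S} {x} Sx = begin
    arcs S S                                ≡⟨ arcs-cong S≗ S≗ ⟩
    arcs (insert x S′) (insert x S′)        ≡⟨ arcs-insert (remove-self x S) ⟩
    arcs S′ S′ + (degIn S′ x + degIn S′ x)  ≡⟨ cong (λ d → arcs S′ S′ + (d + d)) (degIn-remove-self Sx) ⟨
    arcs S′ S′ + (degIn S x + degIn S x)    ∎
    where
    open ≡-Reasoning
    S′ = remove x S
    S≗ : S ≗ insert x S′
    S≗ w = sym (insert-remove {S = S} Sx w)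

  arcs-even : ∀ S → ∃ λ k → arcs S S ≡ 2 * k
  arcs-even S = go (count S) S refl
    where
    go : ∀ m S → count S ≡ m → ∃ λ k → arcs S S ≡ 2 * k
    go zero S count≡0 = 0 , n≤0⇒n≡0 (≤-trans (arcs-≤ S S 0 no-member) (≤-reflexive (*-zeroˡ (count S))))
      where
      no-member : ∀ v → S v ≡ true → degIn S v ≤ 0
      no-member v Sv = ⊥-elim (<-irrefl (sym count≡0) (nonempty⇒count-pos {p = S} Sv))
    go (suc m) S count≡1+m with count-pos⇒nonempty S (subst (0 <_) (sym count≡1+m) (s≤s z≤n))
    ... | x , Sx with go m (remove x S) (suc-injective (trans (sym (count-remove {S = S} Sx)) count≡1+m))
    ... | k , even = k + degIn S x , trans (arcs-remove {S} Sx) (trans (cong (_+ (degIn S x + degIn S x)) even) (regroup k (degIn S x)))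
      where
      regroup : ∀ k d → 2 * k + (d + d) ≡ 2 * (k + d)
      regroup = solve-∀

  Near Far : Fin n → Pred n → Pred n
  Near x T w = T w ∧ adj G x w
  Far  x T w = T w ∧ not (adj G x w)

  count-Near : ∀ x T → count (Near x T) ≡ degIn T x
  count-Near x T = count-cong (λ w → ∧-comm (T w) (adj G x w))

  -- The configuration in which no exchange is available; it forces G ≅ K₃,₃.
  Stuck : Pred n → Fin n → Set
  Stuck T x = ∀ w₁ w₂ → Far x T w₁ ≡ true → adj G w₁ w₂ ≡ true → T w₂ ≡ true → adj G x w₂ ≡ true

  Dense : Pred n → Set
  Dense S = count S + count S ≤ arcs S S

  Good : Pred n → Set
  Good S = Nonempty S × Dense S

  Satisfactory : Pred n → Set
  Satisfactory V₁ = Nonempty V₁ × Nonempty (∁ V₁) × (∀ v → 2 ≤ degIn (own-side V₁ v) v)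

  dense-insert : ∀ {S x} → S x ≡ false →
                 count S + count S + 2 ≤ arcs S S + (degIn S x + degIn S x) → Dense (insert x S)
  dense-insert {S} {x} Sx enough =
    subst₂ _≤_ (trans (twice-suc (count S)) (cong (λ c → c + c) (sym (count-insert {S = S} Sx))))
               (sym (arcs-insert Sx)) enough
    where
    twice-suc : ∀ c → c + c + 2 ≡ suc c + suc c
    twice-suc = solve-∀

  dense-remove : ∀ {S x} → S x ≡ true →
                 count S + count S + (degIn S x + degIn S x) ≤ arcs S S + 2 → Dense (remove x S)
  dense-remove {S} {x} Sx enough =
    cancel (count (remove x S)) (degIn S x + degIn S x) (arcs (remove x S) (remove x S))
      (subst₂ _≤_ (cong (λ c → c + c + (degIn S x + degIn S x)) (count-remove {S = S} Sx))
                  (cong (_+ 2) (arcs-remove Sx)) enough)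
    where
    cancel : ∀ c e a → suc c + suc c + e ≤ a + e + 2 → c + c ≤ a
    cancel c e a ineq = +-cancelʳ-≤ (e + 2) (c + c) a
      (subst₂ _≤_ (regroupˡ c e) (+-assoc a e 2) ineq)
      where
      regroupˡ : ∀ c e → suc c + suc c + e ≡ c + c + (e + 2)
      regroupˡ = solve-∀

-- With t = |T| and u = |∁ T| for a 2-regular T, the even number of arcs inside ∁ T is 3u − t.
outside-of-triangle : ∀ k u → 3 + 2 * k ≡ 3 * u → u < 3 → u ≡ 1
outside-of-triangle k 0 () _
outside-of-triangle k 1 _  _ = refl
outside-of-triangle k 2 eq _ = ⊥-elim (even≢odd k 1 (+-cancelˡ-≡ 3 (2 * k) 3 eq))
outside-of-triangle k (suc (suc (suc u))) _ (s≤s (s≤s (s≤s ())))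

outside-of-square : ∀ k u → 4 + 2 * k ≡ 3 * u → u < 4 → u ≡ 2
outside-of-square k 0 () _
outside-of-square k 1 () _
outside-of-square k 2 _  _ = refl
outside-of-square k 3 eq _ = ⊥-elim (even≢odd k 2 (+-cancelˡ-≡ 4 (2 * k) 5 eq))
outside-of-square k (suc (suc (suc (suc u)))) _ (s≤s (s≤s (s≤s (s≤s ()))))

module Cubic {n : ℕ} (G : Graph n) (cubic : Regular 3 G) where

  open Degrees G

  degIn-+-∁≡3 : ∀ S v → degIn S v + degIn (∁ S) v ≡ 3
  degIn-+-∁≡3 S v = trans (degIn-+-∁ S v) (cubic v)

  degIn-≤3 : ∀ S v → degIn S v ≤ 3
  degIn-≤3 S v = subst (degIn S v ≤_) (degIn-+-∁≡3 S v) (m≤m+n _ _)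

  arcs-≤-3*count : ∀ S → arcs S S ≤ 3 * count S
  arcs-≤-3*count S = arcs-≤ S S 3 (λ v _ → degIn-≤3 S v)

  good-remove-low : ∀ {S x} → S x ≡ true → degIn S x ≤ 1 → Dense S → Good (remove x S)
  good-remove-low {S} {x} Sx low dense =
    count-pos⇒nonempty S′ (positive (count S′) crowded) ,
    dense-remove Sx (+-mono-≤ dense (+-mono-≤ low low))
    where
    S′ = remove x S
    d = degIn S x
    d≤count : d ≤ count S′
    d≤count = subst (_≤ count S′) (sym (degIn-remove-self Sx)) (degIn-≤-count S′ x)
    crowded : suc (count S′) + suc (count S′) ≤ 3 * count S′ + (count S′ + count S′)
    crowded = begin
      suc (count S′) + suc (count S′)  ≡⟨ cong (λ c → c + c) (count-remove {S = S} Sx) ⟨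
      count S + count S                ≤⟨ dense ⟩
      arcs S S                         ≡⟨ arcs-remove Sx ⟩
      arcs S′ S′ + (d + d)             ≤⟨ +-mono-≤ (arcs-≤-3*count S′) (+-mono-≤ d≤count d≤count) ⟩
      3 * count S′ + (count S′ + count S′) ∎
      where open ≤-Reasoning
    positive : ∀ c → suc c + suc c ≤ 3 * c + (c + c) → 0 < c
    positive (suc c) _ = s≤s z≤n

  record GoodSplit : Set where
    field
      X Y    : Pred n
      Y≗∁X   : Y ≗ ∁ X
      good-X : Good X
      good-Y : Good Y

  open GoodSplit

  swap : GoodSplit → GoodSplit
  swap s = record
    { X = Y s ; Y = X s
    ; Y≗∁X = λ w → trans (sym (not-involutive (X s w))) (cong not (sym (Y≗∁X s w)))
    ; good-X = good-Y s ; good-Y = good-X s }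

  potential : GoodSplit → ℕ
  potential s = arcs (X s) (X s) + arcs (Y s) (Y s)

  potential-≤ : ∀ s → potential s ≤ 3 * n
  potential-≤ s = begin
    potential s                          ≤⟨ +-mono-≤ (arcs-≤-3*count (X s)) (arcs-≤-3*count (Y s)) ⟩
    3 * count (X s) + 3 * count (Y s)    ≡⟨ *-distribˡ-+ 3 (count (X s)) (count (Y s)) ⟨
    3 * (count (X s) + count (Y s))      ≡⟨ cong (λ c → 3 * (count (X s) + c)) (count-cong (Y≗∁X s)) ⟩
    3 * (count (X s) + count (∁ (X s)))  ≡⟨ cong (3 *_) (count-+-∁ (X s)) ⟩
    3 * n                                ∎
    where open ≤-Reasoning

  move-out : ∀ s v → X s v ≡ true → degIn (X s) v ≤ 1 →
             Σ GoodSplit λ s′ → potential s + 2 ≤ potential s′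
  move-out s v Xv low = s′ , gain
    where
    X′ = remove v (X s)
    Y′ = insert v (Y s)
    d = degIn (X s) v
    e = degIn (Y s) v
    Yv : Y s v ≡ false
    Yv = trans (Y≗∁X s v) (cong not Xv)
    d+e≡3 : d + e ≡ 3
    d+e≡3 = trans (cong (d +_) (degIn-cong (Y≗∁X s) v)) (degIn-+-∁≡3 (X s) v)
    1+d≤e : suc d ≤ e
    1+d≤e = +-cancelˡ-≤ d (suc d) e (begin
      d + suc d    ≡⟨ +-suc d d ⟩
      suc (d + d)  ≤⟨ s≤s (+-mono-≤ low low) ⟩
      3            ≡⟨ d+e≡3 ⟨
      d + e        ∎)
      where open ≤-Reasoning
    1≤e : 1 ≤ e
    1≤e = ≤-trans (s≤s z≤n) 1+d≤e
    Y′≗∁X′ : Y′ ≗ ∁ X′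
    Y′≗∁X′ w with v ≟ w
    ... | yes refl = refl
    ... | no _     = Y≗∁X s w
    s′ : GoodSplit
    s′ = record
      { X = X′ ; Y = Y′ ; Y≗∁X = Y′≗∁X′
      ; good-X = good-remove-low Xv low (proj₂ (good-X s))
      ; good-Y = (v , cong (_∨ Y s v) (==-refl v)) ,
                 dense-insert Yv (+-mono-≤ (proj₂ (good-Y s)) (+-mono-≤ 1≤e 1≤e)) }
    gain : potential s + 2 ≤ potential s′
    gain = begin
      arcs (X s) (X s) + arcs (Y s) (Y s) + 2
        ≡⟨ cong (λ a → a + arcs (Y s) (Y s) + 2) (arcs-remove Xv) ⟩
      arcs X′ X′ + (d + d) + arcs (Y s) (Y s) + 2
        ≡⟨ regroup (arcs X′ X′) (arcs (Y s) (Y s)) d ⟩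
      arcs X′ X′ + (arcs (Y s) (Y s) + (suc d + suc d))
        ≤⟨ +-monoʳ-≤ (arcs X′ X′) (+-monoʳ-≤ (arcs (Y s) (Y s)) (+-mono-≤ 1+d≤e 1+d≤e)) ⟩
      arcs X′ X′ + (arcs (Y s) (Y s) + (e + e))
        ≡⟨ cong (arcs X′ X′ +_) (arcs-insert Yv) ⟨
      arcs X′ X′ + arcs Y′ Y′ ∎
      where
      open ≤-Reasoning
      regroup : ∀ a b d → a + (d + d) + b + 2 ≡ a + (b + (suc d + suc d))
      regroup = solve-∀

  move-in : ∀ s v → Y s v ≡ true → degIn (Y s) v ≤ 1 →
            Σ GoodSplit λ s′ → potential s + 2 ≤ potential s′
  move-in s v Yv low with move-out (swap s) v Yv low
  ... | s′ , gain = swap s′ , subst₂ (λ p p′ → p + 2 ≤ p′)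
                                      (+-comm (arcs (Y s) (Y s)) (arcs (X s) (X s)))
                                      (+-comm (arcs (X s′) (X s′)) (arcs (Y s′) (Y s′))) gain

  Friendly : GoodSplit → Set
  Friendly s = ∀ v → (X s v ≡ true → 2 ≤ degIn (X s) v) × (Y s v ≡ true → 2 ≤ degIn (Y s) v)

  friendly-split : GoodSplit → Σ GoodSplit Friendly
  friendly-split s₀ = search (suc (3 * n)) s₀ (m≤n+m _ (potential s₀))
    where
    spend : ∀ {p p′ f} → 3 * n < p + suc f → p + 2 ≤ p′ → 3 * n < p′ + f
    spend {p} {p′} {f} budget gain = begin-strict
      3 * n        <⟨ budget ⟩
      p + suc f    ≡⟨ +-suc p f ⟩
      suc (p + f)  <⟨ +-monoˡ-< f (subst (_≤ p′) (+-comm p 2) gain) ⟩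
      p′ + f       ∎
      where open ≤-Reasoning
    search : ∀ fuel s → 3 * n < potential s + fuel → Σ GoodSplit Friendly
    search zero s budget =
      ⊥-elim (<⇒≱ budget (≤-trans (≤-reflexive (+-identityʳ _)) (potential-≤ s)))
    search (suc fuel) s budget
      with any? (λ v → ((X s v ≟ᵇ true) ×-dec (degIn (X s) v ≤? 1))
                    ⊎-dec ((Y s v ≟ᵇ true) ×-dec (degIn (Y s) v ≤? 1)))
    ... | yes (v , inj₁ (Xv , low)) with move-out s v Xv low
    ...   | s′ , gain = search fuel s′ (spend budget gain)
    search (suc fuel) s budget | yes (v , inj₂ (Yv , low)) with move-in s v Yv low
    ...   | s′ , gain = search fuel s′ (spend budget gain)
    search (suc fuel) s budget | no none =
      s , λ v → (λ Xv → ≰⇒> λ low → none (v , inj₁ (Xv , low))) ,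
                (λ Yv → ≰⇒> λ low → none (v , inj₂ (Yv , low)))

  GoodBelow : Pred n → Set
  GoodBelow T = ∃ λ T′ → Good T′ × count T′ < count T

  shrink-low : ∀ {T v} → T v ≡ true → degIn T v ≤ 1 → Dense T → GoodBelow T
  shrink-low {T} Tv low dense =
    _ , good-remove-low Tv low dense , count-remove-< {S = T} Tv

  shrink-mixed : ∀ {T v w} → (∀ u → T u ≡ true → 2 ≤ degIn T u) →
                 T v ≡ true → degIn T v ≡ 3 → T w ≡ true → degIn T w ≡ 2 → GoodBelow T
  shrink-mixed {T} {v} {w} min-two Tv three Tw two =
    remove w T , ((v , trans (remove-≢ T w≢v) Tv) , dense-remove Tw gap) , count-remove-< {S = T} Tw
    where
    w≢v : w ≢ v
    w≢v refl = 3≢2 (trans (sym three) two)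
      where 3≢2 : 3 ≢ 2
            3≢2 ()
    c = count (remove v T)
    t = count T
    min-two′ : ∀ u → remove v T u ≡ true → 2 ≤ degIn T u
    min-two′ u R = min-two u (remove-⊆ v T u R)
    surplus : 2 * t < arcs T T
    surplus = begin-strict
      2 * t                            ≡⟨ cong (2 *_) (count-remove {S = T} Tv) ⟩
      2 * suc c                        ≡⟨ *-suc 2 c ⟩
      2 + 2 * c                        <⟨ n<1+n _ ⟩
      3 + 2 * c                        ≤⟨ +-mono-≤ (≤-reflexive (sym three)) (arcs-≥ (remove v T) T 2 min-two′) ⟩
      degIn T v + arcs (remove v T) T  ≡⟨ arcs-removeˡ Tv T ⟨
      arcs T T                         ∎
      where open ≤-Reasoning
    gap : t + t + (degIn T w + degIn T w) ≤ arcs T T + 2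
    gap with arcs-even T
    ... | k , even = begin
      t + t + (degIn T w + degIn T w)  ≡⟨ cong (λ d → t + t + (d + d)) two ⟩
      t + t + 4                        ≡⟨ regroup t ⟩
      2 * suc t + 2                    ≤⟨ +-monoˡ-≤ 2 (*-monoʳ-≤ 2 (*-cancelˡ-< 2 t k (subst (2 * t <_) even surplus))) ⟩
      2 * k + 2                        ≡⟨ cong (_+ 2) even ⟨
      arcs T T + 2                     ∎
      where
      open ≤-Reasoning
      regroup : ∀ t → t + t + 4 ≡ 2 * suc t + 2
      regroup = solve-∀

  shrink-all-three : ∀ {T v} → (∀ u → T u ≡ true → degIn T u ≡ 3) → T v ≡ true → GoodBelow T
  shrink-all-three {T} {v} all-three Tv =
    T′ , (count-pos⇒nonempty T′ (≤-trans (s≤s z≤n) 3≤c) , dense-remove Tv gap) , count-remove-< {S = T} Tv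
    where
    T′ = remove v T
    c = count T′
    3≤c : 3 ≤ c
    3≤c = subst (_≤ c) (trans (sym (degIn-remove-self Tv)) (all-three v Tv)) (degIn-≤-count T′ v)
    gap : count T + count T + (degIn T v + degIn T v) ≤ arcs T T + 2
    gap = begin
      count T + count T + (degIn T v + degIn T v)  ≡⟨ cong₂ (λ t d → t + t + (d + d)) (count-remove {S = T} Tv) (all-three v Tv) ⟩
      suc c + suc c + 6                            ≡⟨ regroupˡ c ⟩
      c + c + 5 + 3                                ≤⟨ +-monoʳ-≤ (c + c + 5) 3≤c ⟩
      c + c + 5 + c                                ≡⟨ regroupʳ c ⟩
      3 * suc c + 2                                ≡⟨ cong (λ t → 3 * t + 2) (count-remove {S = T} Tv) ⟨
      3 * count T + 2                              ≡⟨ cong (_+ 2) (arcs-≡ T T 3 all-three) ⟨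
      arcs T T + 2                                 ∎
      where
      open ≤-Reasoning
      regroupˡ : ∀ c → suc c + suc c + 6 ≡ c + c + 5 + 3
      regroupˡ = solve-∀
      regroupʳ : ∀ c → c + c + 5 + c ≡ 3 * suc c + 2
      regroupʳ = solve-∀

  module K33-recognition {T : Pred n} {x : Fin n} (Tx : T x ≡ false)
    (x-near-two : degIn T x ≡ 2) (t≡4 : count T ≡ 4) (u≡2 : count (∁ T) ≡ 2) (stuck : Stuck T x)
    where

    Ux : ∁ T x ≡ true
    Ux = cong not Tx

    count-others : count (remove x (∁ T)) ≡ 1
    count-others = suc-injective (trans (sym (count-remove {S = ∁ T} Ux)) u≡2)

    y-found : Nonempty (remove x (∁ T))
    y-found = count-pos⇒nonempty (remove x (∁ T)) (subst (0 <_) (sym count-others) (s≤s z≤n))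

    y : Fin n
    y = proj₁ y-found

    Ty : T y ≡ false
    Ty = not-true (remove-⊆ x (∁ T) y (proj₂ y-found))

    other-outside : ∀ {w} → T w ≡ false → x ≢ w → w ≡ y
    other-outside Tw x≢w = count≤1⇒unique {S = remove x (∁ T)} (≤-reflexive count-others)
                             (trans (remove-≢ (∁ T) x≢w) (cong not Tw)) (proj₂ y-found)

    x∼y : adj G x y ≡ true
    x∼y with count-pos⇒nonempty (λ w → adj G x w ∧ ∁ T w) (subst (0 <_) (sym x-far-one) (s≤s z≤n))
      where
      x-far-one : degIn (∁ T) x ≡ 1
      x-far-one = +-cancelˡ-≡ 2 _ _ (trans (cong (_+ degIn (∁ T) x) (sym x-near-two)) (degIn-+-∁≡3 T x))
    ... | z , x∼z∧Uz = subst (λ v → adj G x v ≡ true) (other-outside Tz x≢z) x∼z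
      where
      x∼z = ∧-conicalˡ (adj G x z) (∁ T z) x∼z∧Uz
      Tz : T z ≡ false
      Tz = not-true (∧-conicalʳ (adj G x z) (∁ T z) x∼z∧Uz)
      x≢z : x ≢ z
      x≢z refl = false≢true (trans (sym (irrefl G x)) x∼z)

    far-two : count (Far x T) ≡ 2
    far-two = +-cancelˡ-≡ 2 _ _ (begin
      2 + count (Far x T)                 ≡⟨ cong (_+ count (Far x T)) (trans (count-Near x T) x-near-two) ⟨
      count (Near x T) + count (Far x T)  ≡⟨ count-split T (adj G x) ⟨
      count T                             ≡⟨ t≡4 ⟩
      4                                   ∎)
      where open ≡-Reasoning

    outside-non-neighbour : ∀ {w} → T w ≡ false → adj G x w ≡ false → w ≡ x
    outside-non-neighbour {w} Tw x≁w with x ≟ w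
    ... | yes x≡w = sym x≡w
    ... | no x≢w  = ⊥-elim (false≢true (trans (sym x≁w)
                      (subst (λ v → adj G x v ≡ true) (sym (other-outside Tw x≢w)) x∼y)))

    twin : ∀ w → adj G x w ≡ false → adj G w ≗ adj G x
    twin w x≁w with T w in Tw
    ... | false = λ v → cong (λ u → adj G u v) (outside-non-neighbour Tw x≁w)
    ... | true  = ⊆∧count≤⇒≗ w⊆x (≤-reflexive (trans (cubic x) (sym (cubic w))))
      where
      w⊆x : adj G w ⊆ adj G x
      w⊆x v w∼v with T v in Tv
      ... | true  = stuck w v (cong₂ _∧_ Tw (cong not x≁w)) w∼v Tv
      ... | false = subst (λ u → adj G x u ≡ true) (sym (other-outside Tv x≢v)) x∼y
        where
        x≢v : x ≢ v
        x≢v refl = false≢true (trans (sym x≁w) (trans (Graph.sym G x w) w∼v))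

    n≡6 : n ≡ 6
    n≡6 = trans (sym (count-+-∁ T)) (cong₂ _+_ t≡4 u≡2)

    bipartite : ∀ u w → adj G u w ≡ adj G x u xor adj G x w
    bipartite u w with adj G x u in x∼u
    ... | false = twin u x∼u w
    ... | true  = sym (⊆∧count≤⇒≗ far⊆u count-far w)
      where
      far⊆u : ∁ (adj G x) ⊆ adj G u
      far⊆u v x≁v = trans (Graph.sym G u v) (trans (twin v (not-true x≁v) u) x∼u)
      count-far : count (adj G u) ≤ count (∁ (adj G x))
      count-far = ≤-reflexive (+-cancelˡ-≡ 3 _ _ (begin
        3 + count (adj G u)                    ≡⟨ cong (3 +_) (cubic u) ⟩
        6                                      ≡⟨ n≡6 ⟨
        n                                      ≡⟨ count-+-∁ (adj G x) ⟨
        count (adj G x) + count (∁ (adj G x))  ≡⟨ cong (_+ count (∁ (adj G x))) (cubic x) ⟩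
        3 + count (∁ (adj G x))                ∎))
        where open ≡-Reasoning

    module _ {a b} (Na : Near x T a ≡ true) (Nb : Near x T b ≡ true) (a≢b : a ≢ b)
             (near-cover : ∀ w → Near x T w ≡ true → w ≡ a ⊎ w ≡ b)
             {c d} (Fc : Far x T c ≡ true) (Fd : Far x T d ≡ true) (c≢d : c ≢ d)
             (far-cover : ∀ w → Far x T w ≡ true → w ≡ c ⊎ w ≡ d) where

      -- The sides of the K₃,₃ are N(x) = {a, b, y} and {c, d, x}.
      label : Fin n → Fin 6
      label w = if adj G x w then (if T w then (if a == w then 0F else 1F) else 2F)
                             else (if T w then (if c == w then 3F else 4F) else 5F)

      vertex : Fin 6 → Fin n
      vertex 0F = a
      vertex 1F = b
      vertex 2F = y
      vertex 3F = c
      vertex 4F = d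
      vertex 5F = x

      side33-label : ∀ w → side33 (label w) ≡ adj G x w
      side33-label w with adj G x w | T w | a == w | c == w
      ... | true  | true  | true  | _     = refl
      ... | true  | true  | false | _     = refl
      ... | true  | false | _     | _     = refl
      ... | false | true  | _     | true  = refl
      ... | false | true  | _     | false = refl
      ... | false | false | _     | _     = refl

      label-vertex : ∀ i → label (vertex i) ≡ i
      label-vertex 0F rewrite ∧-conicalʳ (T a) _ Na | ∧-conicalˡ (T a) _ Na | ==-refl a = refl
      label-vertex 1F rewrite ∧-conicalʳ (T b) _ Nb | ∧-conicalˡ (T b) _ Nb | ==-≢ a≢b = refl
      label-vertex 2F rewrite x∼y | Ty = refl
      label-vertex 3F rewrite not-true (∧-conicalʳ (T c) _ Fc) | ∧-conicalˡ (T c) _ Fc | ==-refl c = refl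
      label-vertex 4F rewrite not-true (∧-conicalʳ (T d) _ Fd) | ∧-conicalˡ (T d) _ Fd | ==-≢ c≢d = refl
      label-vertex 5F rewrite irrefl G x | Tx = refl

      vertex-label : ∀ w → vertex (label w) ≡ w
      vertex-label w with adj G x w in x∼w | T w in Tw
      ... | true  | true  with a ≟ w
      ...   | yes a≡w = a≡w
      ...   | no a≢w with near-cover w (cong₂ _∧_ Tw x∼w)
      ...     | inj₁ w≡a = ⊥-elim (a≢w (sym w≡a))
      ...     | inj₂ w≡b = sym w≡b
      vertex-label w | false | true  with c ≟ w
      ...   | yes c≡w = c≡w
      ...   | no c≢w with far-cover w (cong₂ _∧_ Tw (cong not x∼w))
      ...     | inj₁ w≡c = ⊥-elim (c≢w (sym w≡c))
      ...     | inj₂ w≡d = sym w≡d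
      vertex-label w | true  | false = sym (other-outside Tw x≢w)
        where
        x≢w : x ≢ w
        x≢w refl = false≢true (trans (sym (irrefl G x)) x∼w)
      vertex-label w | false | false = sym (outside-non-neighbour Tw x∼w)

      labelled-≅K33 : G ≅ K33
      labelled-≅K33 = ↔⇒⤖ (mk↔ₛ′ label vertex label-vertex vertex-label) , λ u w →
        trans (bipartite u w) (cong₂ _xor_ (sym (side33-label u)) (sym (side33-label w)))

    ≅K33 : G ≅ K33
    ≅K33 with enumerate₂ {S = Near x T} (trans (count-Near x T) x-near-two)
            | enumerate₂ {S = Far x T} far-two
    ... | _ , _ , Na , Nb , a≢b , near-cover | _ , _ , Fc , Fd , c≢d , far-cover =
      labelled-≅K33 Na Nb a≢b near-cover Fc Fd c≢d far-cover

  module _ {T : Pred n} (two-regular : ∀ u → T u ≡ true → degIn T u ≡ 2) where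

    arcs-two-regular : arcs T T ≡ count T + count T
    arcs-two-regular = trans (arcs-≡ T T 2 two-regular) (cong (count T +_) (+-identityʳ (count T)))

    module _ {w₁ w₂} (Tw₁ : T w₁ ≡ true) (Tw₂ : T w₂ ≡ true) (w₁∼w₂ : adj G w₁ w₂ ≡ true) where

      without-edge : Pred n
      without-edge = remove w₂ (remove w₁ T)

      private
        w₁≢w₂ : w₁ ≢ w₂
        w₁≢w₂ refl = false≢true (trans (sym (irrefl G w₁)) w₁∼w₂)
        T₁w₂ : remove w₁ T w₂ ≡ true
        T₁w₂ = trans (remove-≢ T w₁≢w₂) Tw₂

      count-without-edge : count T ≡ suc (suc (count without-edge))
      count-without-edge =
        trans (count-remove {S = T} Tw₁) (cong suc (count-remove {S = remove w₁ T} T₁w₂))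

      degIn-without-edge : ∀ v → degIn T v ≡ 𝟙 (adj G v w₁) + (𝟙 (adj G v w₂) + degIn without-edge v)
      degIn-without-edge v =
        trans (degIn-remove Tw₁ v) (cong (𝟙 (adj G v w₁) +_) (degIn-remove T₁w₂ v))

      arcs-without-edge : arcs T T ≡ arcs without-edge without-edge + 6
      arcs-without-edge = begin
        arcs T T                                      ≡⟨ arcs-remove Tw₁ ⟩
        arcs T₁ T₁ + (degIn T w₁ + degIn T w₁)        ≡⟨ cong (λ d → arcs T₁ T₁ + (d + d)) (two-regular w₁ Tw₁) ⟩
        arcs T₁ T₁ + 4                                ≡⟨ cong (_+ 4) (arcs-remove T₁w₂) ⟩
        arcs T₂ T₂ + (degIn T₁ w₂ + degIn T₁ w₂) + 4  ≡⟨ cong (λ d → arcs T₂ T₂ + (d + d) + 4) w₂-one ⟩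
        arcs T₂ T₂ + 2 + 4                            ≡⟨ +-assoc (arcs T₂ T₂) 2 4 ⟩
        arcs T₂ T₂ + 6                                ∎
        where
        open ≡-Reasoning
        T₁ = remove w₁ T
        T₂ = without-edge
        w₂-one : degIn T₁ w₂ ≡ 1
        w₂-one = suc-injective (begin
          suc (degIn T₁ w₂)              ≡⟨ cong (λ b → 𝟙 b + degIn T₁ w₂) (trans (Graph.sym G w₂ w₁) w₁∼w₂) ⟨
          𝟙 (adj G w₂ w₁) + degIn T₁ w₂  ≡⟨ degIn-remove Tw₁ w₂ ⟨
          degIn T w₂                     ≡⟨ two-regular w₂ Tw₂ ⟩
          2                              ∎)

    exchange : ∀ {x w₁ w₂} → T x ≡ false → T w₁ ≡ true → T w₂ ≡ true → adj G w₁ w₂ ≡ true →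
               adj G x w₁ ≡ false → 𝟙 (adj G x w₂) + 2 ≤ degIn T x → GoodBelow T
    exchange {x} {w₁} {w₂} Tx Tw₁ Tw₂ w₁∼w₂ x≁w₁ enough =
      insert x T₂ , ((x , cong (_∨ T₂ x) (==-refl x)) , dense) , smaller
      where
      T₂ = without-edge Tw₁ Tw₂ w₁∼w₂
      c  = count T₂
      e  = degIn T₂ x
      T₂x : T₂ x ≡ false
      T₂x with T₂ x in T₂x
      ... | false = refl
      ... | true  = sym (trans (sym Tx) (remove-⊆ w₁ T x (remove-⊆ w₂ (remove w₁ T) x T₂x)))
      smaller : count (insert x T₂) < count T
      smaller = subst₂ _<_ (sym (count-insert {S = T₂} T₂x)) (sym (count-without-edge Tw₁ Tw₂ w₁∼w₂)) ≤-refl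
      2≤e : 2 ≤ e
      2≤e = +-cancelˡ-≤ (𝟙 (adj G x w₂)) 2 e
              (subst (𝟙 (adj G x w₂) + 2 ≤_)
                     (trans (degIn-without-edge Tw₁ Tw₂ w₁∼w₂ x) (cong (λ b → 𝟙 b + (𝟙 (adj G x w₂) + e)) x≁w₁)) enough)
      dense : Dense (insert x T₂)
      dense = dense-insert T₂x (+-cancelʳ-≤ 6 _ _ (begin
        c + c + 2 + 6                  ≡⟨ regroupˡ c ⟩
        suc (suc c) + suc (suc c) + 4  ≡⟨ cong (λ t → t + t + 4) (count-without-edge Tw₁ Tw₂ w₁∼w₂) ⟨
        count T + count T + 4          ≡⟨ cong (_+ 4) arcs-two-regular ⟨
        arcs T T + 4                   ≤⟨ +-monoʳ-≤ (arcs T T) (+-mono-≤ 2≤e 2≤e) ⟩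
        arcs T T + (e + e)             ≡⟨ cong (_+ (e + e)) (arcs-without-edge Tw₁ Tw₂ w₁∼w₂) ⟩
        arcs T₂ T₂ + 6 + (e + e)       ≡⟨ regroupʳ (arcs T₂ T₂) (e + e) ⟩
        arcs T₂ T₂ + (e + e) + 6       ∎))
        where
        open ≤-Reasoning
        regroupˡ : ∀ c → c + c + 2 + 6 ≡ suc (suc c) + suc (suc c) + 4
        regroupˡ = solve-∀
        regroupʳ : ∀ a b → a + 6 + b ≡ a + b + 6
        regroupʳ = solve-∀

    degIn-∁-two-regular : ∀ v → T v ≡ true → degIn (∁ T) v ≡ 1
    degIn-∁-two-regular v Tv = +-cancelˡ-≡ 2 _ _
      (trans (cong (_+ degIn (∁ T) v) (sym (two-regular v Tv))) (degIn-+-∁≡3 T v))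

    arcs-∁-T : arcs (∁ T) T ≡ count T
    arcs-∁-T = trans (arcs-sym (∁ T) T)
                     (trans (arcs-≡ T (∁ T) 1 degIn-∁-two-regular) (*-identityˡ (count T)))

    arcs-∁ : count T + arcs (∁ T) (∁ T) ≡ 3 * count (∁ T)
    arcs-∁ = begin
      count T + arcs (∁ T) (∁ T)       ≡⟨ +-comm (count T) _ ⟩
      arcs (∁ T) (∁ T) + count T       ≡⟨ cong (arcs (∁ T) (∁ T) +_) arcs-∁-T ⟨
      arcs (∁ T) (∁ T) + arcs (∁ T) T  ≡⟨ cong (arcs (∁ T) (∁ T) +_)
                                                       (arcs-cong (λ _ → refl) (sym ∘ not-involutive ∘ T)) ⟩
      arcs (∁ T) (∁ T) + arcs (∁ T) (∁ (∁ T)) ≡⟨ arcs-+-∁ cubic (∁ T) (∁ T) ⟩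
      3 * count (∁ T)                         ∎
      where open ≡-Reasoning

    sparse-∁ : ¬ Dense (∁ T) → count (∁ T) < count T
    sparse-∁ sparse = ≰⇒> λ t≤u → sparse (+-cancelʳ-≤ (count T) _ _ (begin
      u + u + count T             ≤⟨ +-monoʳ-≤ (u + u) t≤u ⟩
      u + u + u                   ≡⟨ thrice u ⟩
      3 * u                       ≡⟨ arcs-∁ ⟨
      count T + arcs (∁ T) (∁ T)  ≡⟨ +-comm (count T) _ ⟩
      arcs (∁ T) (∁ T) + count T  ∎))
      where
      open ≤-Reasoning
      u = count (∁ T)
      thrice : ∀ u → u + u + u ≡ 3 * u
      thrice = solve-∀

    heavy-outside : count (∁ T) < count T → ∃ λ x → T x ≡ false × 2 ≤ degIn T x
    heavy-outside u<t with any? (λ x → (∁ T x ≟ᵇ true) ×-dec (2 ≤? degIn T x))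
    ... | yes (x , Ux , heavy) = x , not-true Ux , heavy
    ... | no none = ⊥-elim (<⇒≱ u<t (begin
      count T          ≡⟨ arcs-∁-T ⟨
      arcs (∁ T) T     ≤⟨ arcs-≤ (∁ T) T 1 light ⟩
      1 * count (∁ T)  ≡⟨ *-identityˡ (count (∁ T)) ⟩
      count (∁ T)      ∎))
      where
      open ≤-Reasoning
      light : ∀ x → ∁ T x ≡ true → degIn T x ≤ 1
      light x Ux = s≤s⁻¹ (≰⇒> λ heavy → none (x , Ux , heavy))

    three-≤-count : Nonempty T → 3 ≤ count T
    three-≤-count (v , Tv) = subst (3 ≤_) (sym (count-remove {S = T} Tv))
      (s≤s (subst (_≤ count (remove v T)) (trans (sym (degIn-remove-self Tv)) (two-regular v Tv))
                  (degIn-≤-count (remove v T) v)))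

    outside-equation : ∀ {t k} → count T ≡ t → arcs (∁ T) (∁ T) ≡ 2 * k → t + 2 * k ≡ 3 * count (∁ T)
    outside-equation refl even = subst (λ a → count T + a ≡ 3 * count (∁ T)) even arcs-∁

    triangle⇒n≡4 : count T ≡ 3 → count (∁ T) < count T → n ≡ 4
    triangle⇒n≡4 t≡3 u<t with arcs-even (∁ T)
    ... | k , even = begin
      n                      ≡⟨ count-+-∁ T ⟨
      count T + count (∁ T)  ≡⟨ cong₂ _+_ t≡3 (outside-of-triangle k _ (outside-equation {k = k} t≡3 even)
                                                                     (subst (count (∁ T) <_) t≡3 u<t)) ⟩
      4                      ∎
      where open ≡-Reasoning

    stuck⇒count≤4 : ∀ {x} → degIn T x ≡ 2 → Stuck T x → count T ≤ 4
    stuck⇒count≤4 {x} x-near-two stuck = begin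
      count T                             ≡⟨ count-split T (adj G x) ⟩
      count (Near x T) + count (Far x T)  ≤⟨ +-mono-≤ (≤-reflexive near-two) far≤2 ⟩
      4                                   ∎
      where
      open ≤-Reasoning
      near-two : count (Near x T) ≡ 2
      near-two = trans (count-Near x T) x-near-two
      far-degree : ∀ w → Far x T w ≡ true → degIn (Near x T) w ≡ 2
      far-degree w Fw = trans (count-cong T-nbr-near) (two-regular w (∧-conicalˡ _ _ Fw))
        where
        T-nbr-near : ∀ v → adj G w v ∧ Near x T v ≡ adj G w v ∧ T v
        T-nbr-near v with adj G w v in w∼v | T v in Tv
        ... | true  | true  = stuck w v Fw w∼v Tv
        ... | true  | false = refl
        ... | false | _     = refl
      near-degree : ∀ w → Near x T w ≡ true → degIn (Far x T) w ≤ 2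
      near-degree w Nw = ≤-trans (count-mono far⊆T) (≤-reflexive (two-regular w (∧-conicalˡ _ _ Nw)))
        where
        far⊆T : (λ v → adj G w v ∧ Far x T v) ⊆ (λ v → adj G w v ∧ T v)
        far⊆T v with adj G w v | T v
        ... | true | true = λ _ → refl
      far≤2 : count (Far x T) ≤ 2
      far≤2 = *-cancelˡ-≤ 2 (begin
        2 * count (Far x T)        ≡⟨ arcs-≡ (Far x T) (Near x T) 2 far-degree ⟨
        arcs (Far x T) (Near x T)  ≡⟨ arcs-sym (Far x T) (Near x T) ⟩
        arcs (Near x T) (Far x T)  ≤⟨ arcs-≤ (Near x T) (Far x T) 2 near-degree ⟩
        2 * count (Near x T)       ≡⟨ cong (2 *_) near-two ⟩
        4                          ∎)

    shrink-or-stuck : ∀ {x} → T x ≡ false → degIn T x ≡ 2 → GoodBelow T ⊎ Stuck T x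
    shrink-or-stuck {x} Tx x-near-two
      with any? (λ w₁ → any? (λ w₂ → (Far x T w₁ ≟ᵇ true) ×-dec
                                      ((adj G w₁ w₂ ≟ᵇ true) ×-dec (Far x T w₂ ≟ᵇ true))))
    ... | yes (w₁ , w₂ , Fw₁ , w₁∼w₂ , Fw₂) =
      inj₁ (exchange Tx (∧-conicalˡ _ _ Fw₁) (∧-conicalˡ _ _ Fw₂) w₁∼w₂ (not-true (∧-conicalʳ _ _ Fw₁))
                     (≤-reflexive (trans (cong (λ b → 𝟙 b + 2) (not-true (∧-conicalʳ _ _ Fw₂))) (sym x-near-two))))
    ... | no none = inj₂ stuck
      where
      stuck : Stuck T x
      stuck w₁ w₂ Fw₁ w₁∼w₂ Tw₂ with adj G x w₂ in x∼w₂
      ... | true  = refl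
      ... | false = ⊥-elim (none (w₁ , w₂ , Fw₁ , w₁∼w₂ , cong₂ _∧_ Tw₂ (cong not x∼w₂)))

    shrink-near-three : ∀ {x} → T x ≡ false → degIn T x ≡ 3 → 4 ≤ count T → GoodBelow T
    shrink-near-three {x} Tx x-near-three 4≤t =
      exchange Tx Tw₁ Tw₂ w₁∼w₂ (not-true (∧-conicalʳ _ _ Fw₁))
               (subst (𝟙 (adj G x w₂) + 2 ≤_) (sym x-near-three) (+-monoˡ-≤ 2 (𝟙≤1 (adj G x w₂))))
      where
      far-nonempty : 0 < count (Far x T)
      far-nonempty = +-cancelˡ-≤ 3 1 (count (Far x T)) (begin
        4                                   ≤⟨ 4≤t ⟩
        count T                             ≡⟨ count-split T (adj G x) ⟩
        count (Near x T) + count (Far x T)  ≡⟨ cong (_+ count (Far x T)) (trans (count-Near x T) x-near-three) ⟩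
        3 + count (Far x T)                 ∎)
        where open ≤-Reasoning
      w₁-found = count-pos⇒nonempty (Far x T) far-nonempty
      w₁ = proj₁ w₁-found
      Fw₁ = proj₂ w₁-found
      Tw₁ = ∧-conicalˡ _ _ Fw₁
      w₂-found = count-pos⇒nonempty (λ w → adj G w₁ w ∧ T w)
                   (subst (0 <_) (sym (two-regular w₁ Tw₁)) (s≤s z≤n))
      w₂ = proj₁ w₂-found
      w₁∼w₂ = ∧-conicalˡ _ _ (proj₂ w₂-found)
      Tw₂ = ∧-conicalʳ _ _ (proj₂ w₂-found)

    ∁-nonempty : Nonempty T → Nonempty (∁ T)
    ∁-nonempty (v , Tv) with count-pos⇒nonempty (λ w → adj G v w ∧ ∁ T w)
                               (subst (0 <_) (sym (degIn-∁-two-regular v Tv)) (s≤s z≤n))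
    ... | w , v∼w∧Uw = w , ∧-conicalʳ _ _ v∼w∧Uw

    shrink-two-regular : Nonempty T → ¬ Good (∁ T) → n ≢ 4 → ¬ (G ≅ K33) → GoodBelow T
    shrink-two-regular T-nonempty ¬good-∁ n≢4 ¬K33 = shrink-at (heavy-outside u<t)
      where
      u<t = sparse-∁ (λ dense-∁ → ¬good-∁ (∁-nonempty T-nonempty , dense-∁))
      4≤t : count T ≢ 3 → 4 ≤ count T
      4≤t t≢3 = ≤∧≢⇒< (three-≤-count T-nonempty) (t≢3 ∘ sym)
      shrink-near-two : ∀ {x} → T x ≡ false → degIn T x ≡ 2 → 4 ≤ count T → GoodBelow T
      shrink-near-two Tx near-two 4≤t with shrink-or-stuck Tx near-two
      ... | inj₁ below = below
      ... | inj₂ stuck = ⊥-elim (¬K33 (K33-recognition.≅K33 Tx near-two t≡4 u≡2 stuck))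
        where
        t≡4 = ≤-antisym (stuck⇒count≤4 near-two stuck) 4≤t
        even = arcs-even (∁ T)
        u≡2 = outside-of-square (proj₁ even) _ (outside-equation {k = proj₁ even} t≡4 (proj₂ even)) (subst (count (∁ T) <_) t≡4 u<t)
      shrink-at : (∃ λ x → T x ≡ false × 2 ≤ degIn T x) → GoodBelow T
      shrink-at (x , Tx , heavy) with count T ℕ.≟ 3 | degIn T x ℕ.≟ 3
      ... | yes t≡3 | _              = ⊥-elim (n≢4 (triangle⇒n≡4 t≡3 u<t))
      ... | no t≢3  | yes near-three = shrink-near-three Tx near-three (4≤t t≢3)
      ... | no t≢3  | no ¬near-three =
        shrink-near-two Tx (≤-antisym (s≤s⁻¹ (≤∧≢⇒< (degIn-≤3 T x) ¬near-three)) heavy) (4≤t t≢3)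

  module _ (n≢4 : n ≢ 4) (¬K33 : ¬ (G ≅ K33)) where

    shrink-min-two : ∀ {T} → Nonempty T → ¬ Good (∁ T) → (∀ u → T u ≡ true → 2 ≤ degIn T u) → GoodBelow T
    shrink-min-two {T} T-nonempty ¬good-∁ min-two
      with any? (λ v → (T v ≟ᵇ true) ×-dec (degIn T v ℕ.≟ 3))
         | any? (λ w → (T w ≟ᵇ true) ×-dec (degIn T w ℕ.≟ 2))
    ... | yes (v , Tv , three) | yes (w , Tw , two) = shrink-mixed min-two Tv three Tw two
    ... | yes (v , Tv , three) | no no-two = shrink-all-three all-three Tv
      where
      all-three : ∀ u → T u ≡ true → degIn T u ≡ 3
      all-three u Tu = ≤-antisym (degIn-≤3 T u) (≤∧≢⇒< (min-two u Tu) (λ 2≡d → no-two (u , Tu , sym 2≡d)))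
    ... | no no-three | _ = shrink-two-regular two-regular T-nonempty ¬good-∁ n≢4 ¬K33
      where
      two-regular : ∀ u → T u ≡ true → degIn T u ≡ 2
      two-regular u Tu = ≤-antisym (s≤s⁻¹ (≤∧≢⇒< (degIn-≤3 T u) (λ d≡3 → no-three (u , Tu , d≡3)))) (min-two u Tu)

    shrink : ∀ {T} → Good T → ¬ Good (∁ T) → GoodBelow T
    shrink {T} (T-nonempty , dense) ¬good-∁ with any? (λ v → (T v ≟ᵇ true) ×-dec (degIn T v ≤? 1))
    ... | yes (v , Tv , low) = shrink-low Tv low dense
    ... | no no-low = shrink-min-two T-nonempty ¬good-∁ (λ u Tu → ≰⇒> λ low → no-low (u , Tu , low))

    good? : ∀ S → Dec (Good S)
    good? S = any? (λ w → S w ≟ᵇ true) ×-dec (count S + count S ≤? arcs S S)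

    split-from : ∀ fuel T → count T < fuel → Good T → GoodSplit
    split-from (suc fuel) T t<fuel good-T with good? (∁ T)
    ... | yes good-∁ = record { X = T ; Y = ∁ T ; Y≗∁X = λ _ → refl ; good-X = good-T ; good-Y = good-∁ }
    ... | no ¬good-∁ with shrink good-T ¬good-∁
    ...   | T′ , good-T′ , smaller = split-from fuel T′ (<-≤-trans smaller (s≤s⁻¹ t<fuel)) good-T′

    initial-split : 0 < n → GoodSplit
    initial-split 0<n = split-from (suc n) (λ _ → true) (s≤s (≤-reflexive count-all))
                                   ((Fin.fromℕ< 0<n , refl) , dense-all)
      where
      count-all : count {n} (λ _ → true) ≡ n
      count-all = trans (count-const {n} true) (*-identityʳ n)
      dense-all : Dense (λ _ → true)
      dense-all = subst (c + c ≤_) (sym (arcs-≡ (λ _ → true) (λ _ → true) 3 all-degree))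
                        (+-monoʳ-≤ c (m≤m+n c (c + 0)))
        where
        c = count {n} (λ _ → true)
        all-degree : ∀ v → true ≡ true → degIn (λ _ → true) v ≡ 3
        all-degree v _ = trans (count-cong (λ w → ∧-identityʳ (adj G v w))) (cubic v)

    satisfactory-partition : 0 < n → Σ (Pred n) (Satisfactory)
    satisfactory-partition 0<n with friendly-split (initial-split 0<n)
    ... | s , friendly = X s , proj₁ (good-X s) , Y-nonempty , two-on-own-side
      where
      Y-nonempty : Nonempty (∁ (X s))
      Y-nonempty = proj₁ (proj₁ (good-Y s)) , trans (sym (Y≗∁X s _)) (proj₂ (proj₁ (good-Y s)))
      two-on-own-side : ∀ v → 2 ≤ degIn (own-side (X s) v) v
      two-on-own-side v with X s v in Xv
      ... | true  = subst (2 ≤_) (degIn-cong own≗X v) (proj₁ (friendly v) Xv)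
        where
        own≗X : ∀ w → X s w ≡ not (X s w xor true)
        own≗X w with X s w
        ... | true  = refl
        ... | false = refl
      ... | false = subst (2 ≤_) (degIn-cong own≗Y v) (proj₂ (friendly v) (trans (Y≗∁X s v) (cong not Xv)))
        where
        own≗Y : ∀ w → Y s w ≡ not (X s w xor false)
        own≗Y w rewrite Y≗∁X s w with X s w
        ... | true  = refl
        ... | false = refl

cubic-on-four-≅K4 : (G : Graph 4) → Regular 3 G → G ≅ K4
cubic-on-four-≅K4 G cubic = ⤖-id (Fin 4) , λ u v → ⊆∧count≤⇒≗ (adj⊆neq u) (K4-degree u) v
  where
  adj⊆neq : ∀ u → adj G u ⊆ neq u
  adj⊆neq u v u∼v with u ≟ v
  ... | yes refl = ⊥-elim (false≢true (trans (sym (irrefl G u)) u∼v))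
  ... | no _     = refl
  K4-degree : ∀ u → count (neq u) ≤ count (adj G u)
  K4-degree u = ≤-reflexive (trans (K4-cubic u) (sym (cubic u)))
    where
    K4-cubic : Regular 3 K4
    K4-cubic 0F = refl
    K4-cubic 1F = refl
    K4-cubic 2F = refl
    K4-cubic 3F = refl

-- Imported only here: Data.Integer's prefix +_ makes sections such as (c +_) ambiguous.
open import Data.Integer using (+_)
open import Data.Rational using (_/_)
import Data.Rational as ℚ using (_≤_)
import Data.Rational.Properties as ℚ

three-quarters-≤ : ∀ {d} → 2 ≤ d → d ≤ 3 → + 3 / 4 ℚ.≤ + suc d / 4
three-quarters-≤ {1} (s≤s ()) _
three-quarters-≤ {2} _ _ = ℚ.≤-refl
three-quarters-≤ {3} _ _ = from-yes (+ 3 / 4 ℚ.≤? + 4 / 4)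
three-quarters-≤ {suc (suc (suc (suc _)))} _ (s≤s (s≤s (s≤s ())))

≤-three-quarters : ∀ {d} → d ≤ 2 → + suc d / 4 ℚ.≤ + 3 / 4
≤-three-quarters {0} _ = from-yes (+ 1 / 4 ℚ.≤? + 3 / 4)
≤-three-quarters {1} _ = from-yes (+ 2 / 4 ℚ.≤? + 3 / 4)
≤-three-quarters {2} _ = ℚ.≤-refl
≤-three-quarters {suc (suc (suc _))} (s≤s (s≤s ()))

module _ {n : ℕ} (G : Graph n) (cubic : Regular 3 G) where

  open Degrees G
  open Cubic G cubic

  qv-≡ : ∀ P v → qv G P v ≡ + suc (degIn (own-side (σ P) v) v) / 4
  qv-≡ P v = cong₂ (λ c d → + c / suc d) closed-count (cubic v)
    where
    S = own-side (σ P) v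
    closed-count : count (λ w → if inClosedNbhd G v w then S w else false) ≡ suc (degIn S v)
    closed-count = trans (count-+ split) (cong (_+ degIn S v) (count-singleton v))
      where
      split : ∀ w → 𝟙 (if inClosedNbhd G v w then S w else false) ≡ 𝟙 (v == w) + 𝟙 (adj G v w ∧ S w)
      split w with v ≟ w
      ... | yes refl rewrite xor-same (σ P v) | irrefl G v = refl
      ... | no _ with adj G v w
      ...   | true  = refl
      ...   | false = refl

  crossing-edge : ∀ (V₁ : Pred n) {u w} → Reach G u w → V₁ u ≡ true → V₁ w ≡ false →
                  ∃ λ p → ∃ λ q → adj G p q ≡ true × V₁ p ≡ true × V₁ q ≡ false
  crossing-edge V₁ here V₁u V₁w = ⊥-elim (false≢true (trans (sym V₁w) V₁u))
  crossing-edge V₁ {u} (step {v = v} u∼v v↝w) V₁u V₁w with V₁ v in V₁v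
  ... | true  = crossing-edge V₁ v↝w V₁v V₁w
  ... | false = u , v , u∼v , V₁u , V₁v

  lower-bound : Σ (Pred n) Satisfactory → Σ (Partition G) λ P → ∀ v → + 3 / 4 ℚ.≤ qv G P v
  lower-bound (V₁ , V₁-nonempty , V₂-nonempty , two-on-own-side) = P , λ v →
    subst (+ 3 / 4 ℚ.≤_) (sym (qv-≡ P v)) (three-quarters-≤ (two-on-own-side v) (degIn-≤3 _ v))
    where
    P : Partition G
    P = record { σ = V₁ ; nonempty₁ = V₁-nonempty
               ; nonempty₂ = proj₁ V₂-nonempty , not-true (proj₂ V₂-nonempty) }

  upper-bound : Connected G → ∀ P → ∃ λ v → qv G P v ℚ.≤ + 3 / 4
  upper-bound connected P
    with crossing-edge (σ P) (connected (proj₁ (nonempty₁ P)) (proj₁ (nonempty₂ P)))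
                       (proj₂ (nonempty₁ P)) (proj₂ (nonempty₂ P))
  ... | p , q , p∼q , V₁p , V₁q = p , subst (ℚ._≤ + 3 / 4) (sym (qv-≡ P p)) (≤-three-quarters own≤2)
    where
    S = own-side (σ P) p
    q-other : ∁ S q ≡ true
    q-other rewrite V₁p | V₁q = refl
    1≤other : 1 ≤ degIn (∁ S) p
    1≤other = nonempty⇒count-pos {p = λ w → adj G p w ∧ ∁ S w} (cong₂ _∧_ p∼q q-other)
    own≤2 : degIn S p ≤ 2
    own≤2 = +-cancelʳ-≤ 1 _ _ (subst (degIn S p + 1 ≤_) (degIn-+-∁≡3 S p)
                                     (+-monoʳ-≤ (degIn S p) 1≤other))

proposition6 : ∀ (n : ℕ) (G : Graph n) → 0 < n → Connected G → Regular 3 G →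
    ¬ (G ≅ K4) → ¬ (G ≅ K33) → HasQ G (+ 3 / 4)
proposition6 n G 0<n connected cubic ¬K4 ¬K33 with n ℕ.≟ 4
... | yes refl = ⊥-elim (¬K4 (cubic-on-four-≅K4 G cubic))
... | no n≢4   = lower-bound G cubic (Cubic.satisfactory-partition G cubic n≢4 ¬K33 0<n) ,
                 upper-bound G cubic connected
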